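{- For each integer $n\ge1$ there is a positive $\exists\forall$-sentence in the language of lattices which is true in the free lattice $\mathbf F_n$ and false in the free lattice $\mathbf F_{n+1}$. In particular, finitely generated free lattices are pairwise distinguished by positive first-order sentences.
   Context: $\mathbf F_n$ denotes the free lattice on $n$ generators. A positive first-order sentence is one built from atomic formulas (equations or inequalities $s\le t$ between lattice terms) using only conjunction, disjunction, and the quantifiers $\exists,\forall$ (no negations). An $\exists\forall$-sentence is one in prenex form consisting of a block of existential quantifiers followed by a block of universal quantifiers followed by a quantifier-free formula (either block may be empty). -}

module Defs where

open import Data.Nat using (ℕ; _+_)
open import Data.Fin using (Fin)
open import Data.Product using (Σ; _×_)
open import Data.Sum using (_⊎_)
open import Function using (_∘_)
open import Data.Fin using (_↑ˡ_; _↑ʳ_)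
open import Data.Fin using (splitAt)
open import Data.Sum using ([_,_])

data Term (k : ℕ) : Set where
  var  : Fin k → Term k
  _∧ₜ_ : Term k → Term k → Term k
  _∨ₜ_ : Term k → Term k → Term k

infixr 7 _∧ₜ_
infixr 6 _∨ₜ_

-- The free lattice F n: lattice terms over n generators, ordered by the
-- least preorder generated by the lattice axioms (meet = glb, join = lub).
-- Elements of F n are terms; equality in F n is s ⊑ t and t ⊑ s.

data _⊑_ {n : ℕ} : Term n → Term n → Set where
  ⊑-refl  : ∀ {s} → s ⊑ s
  ⊑-trans : ∀ {s t u} → s ⊑ t → t ⊑ u → s ⊑ u
  ∧-lbˡ   : ∀ {s t} → (s ∧ₜ t) ⊑ s
  ∧-lbʳ   : ∀ {s t} → (s ∧ₜ t) ⊑ t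
  ∧-glb   : ∀ {u s t} → u ⊑ s → u ⊑ t → u ⊑ (s ∧ₜ t)
  ∨-ubˡ   : ∀ {s t} → s ⊑ (s ∨ₜ t)
  ∨-ubʳ   : ∀ {s t} → t ⊑ (s ∨ₜ t)
  ∨-lub   : ∀ {s t u} → s ⊑ u → t ⊑ u → (s ∨ₜ t) ⊑ u

infix 4 _⊑_

F : ℕ → Set
F n = Term n

eval : ∀ {k n} → (Fin k → F n) → Term k → F n
eval ρ (var i)  = ρ i
eval ρ (s ∧ₜ t) = eval ρ s ∧ₜ eval ρ t
eval ρ (s ∨ₜ t) = eval ρ s ∨ₜ eval ρ t

data PQF (k : ℕ) : Set where
  _≐_  : Term k → Term k → PQF k
  _≼_  : Term k → Term k → PQF k
  _and_ : PQF k → PQF k → PQF k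
  _or_  : PQF k → PQF k → PQF k

SatQF : ∀ {k} (n : ℕ) → (Fin k → F n) → PQF k → Set
SatQF n ρ (s ≐ t)   = (eval ρ s ⊑ eval ρ t) × (eval ρ t ⊑ eval ρ s)
SatQF n ρ (s ≼ t)   = eval ρ s ⊑ eval ρ t
SatQF n ρ (φ and ψ) = SatQF n ρ φ × SatQF n ρ ψ
SatQF n ρ (φ or ψ)  = SatQF n ρ φ ⊎ SatQF n ρ ψ

-- Positive ∃∀-sentences: ∃ x₁…xₑ ∀ y₁…yₐ φ(x,y), with φ positive
-- quantifier-free; variables 0..e-1 are the existential ones, e..e+a-1
-- the universal ones.

record PosEA : Set where
  constructor ∃∀[_,_,_]
  field
    nE  : ℕ
    nA  : ℕ
    mat : PQF (nE + nA)

_⊕_ : ∀ {e a n} → (Fin e → F n) → (Fin a → F n) → Fin (e + a) → F n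
_⊕_ {e} α β i = [ α , β ] (splitAt e i)

_⊨_ : ℕ → PosEA → Set
n ⊨ ∃∀[ e , a , φ ] =
  Σ (Fin e → F n) λ α → (β : Fin a → F n) → SatQF n (α ⊕ β) φ

{-# OPTIONS --safe #-}
module Submission where

-- With x₁ … xₙ the generators of F n, every y ∈ F n satisfies
-- ⋀ x ≤ y ≤ ⋁ x and, for every S ⊆ {1 … n}, either ⋀_{i ∈ S} xᵢ ≤ y or
-- y ≤ ⋁_{i ∉ S} xᵢ (induction on y).  So F n satisfies
--   ∃ x₁ … xₙ ∀ y . ⋀ x ≤ y ≤ ⋁ x  ∧  ⋀_S (⋀_{i ∈ S} xᵢ ≤ y  ∨  y ≤ ⋁_{i ∉ S} xᵢ).
-- To refute this in F (n + 1), send its generators to 0, 1, …, n in the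
-- chain ℕ.  By pigeonhole some generator y takes a value V that no xᵢ takes; the first
-- clause puts V strictly between min x and max x, and S = {i | V < xᵢ}
-- then gives ⋀_{i ∈ S} xᵢ > V > ⋁_{i ∉ S} xᵢ in the chain.

open import Defs
open import Data.Nat using (ℕ; zero; suc; _+_; _≥_; _≤_; _<_; _⊓_; _⊔_; _<?_; _≟_)
open import Data.Nat.Properties
  using (≤-refl; ≤-trans; m⊓n≤m; m⊓n≤n; ⊓-glb; m≤m⊔n; m≤n⊔m; ⊔-lub; ⊓-sel; ⊔-sel;
         ≤∧≢⇒<; ≮⇒≥; <⇒≢; <⇒≱; n<1+n)
open import Data.Fin using (Fin; zero; suc; toℕ; _↑ˡ_; _↑ʳ_)
open import Data.Fin.Properties using (splitAt-↑ˡ; splitAt-↑ʳ; pigeonhole; ¬∀⟶∃¬; any?)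
open import Data.Fin.Subset using (Subset; inside; outside)
open import Data.Vec using ([]; _∷_; lookup; tabulate)
open import Data.Vec.Properties using (lookup∘tabulate)
open import Data.Bool using (if_then_else_)
open import Data.Product using (Σ; _×_; _,_; proj₁; proj₂; ∃)
open import Data.Sum using (_⊎_; inj₁; inj₂; [_,_])
import Data.Sum as Sum
open import Relation.Nullary using (¬_; Dec; yes; no; does)
open import Relation.Binary.PropositionalEquality
  using (_≡_; _≢_; refl; sym; trans; cong; cong₂; subst₂)
open import Function using (_∘_)

⋀ : ∀ {k m} → (Fin (suc k) → Term m) → Term m
⋀ {zero}  f = f zero
⋀ {suc k} f = f zero ∧ₜ ⋀ (f ∘ suc)

⋁ : ∀ {k m} → (Fin (suc k) → Term m) → Term m
⋁ {zero}  f = f zero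
⋁ {suc k} f = f zero ∨ₜ ⋁ (f ∘ suc)

⋀-lb : ∀ {k m} (f : Fin (suc k) → Term m) i → ⋀ f ⊑ f i
⋀-lb {zero}  f zero    = ⊑-refl
⋀-lb {suc k} f zero    = ∧-lbˡ
⋀-lb {suc k} f (suc i) = ⊑-trans ∧-lbʳ (⋀-lb (f ∘ suc) i)

⋁-ub : ∀ {k m} (f : Fin (suc k) → Term m) i → f i ⊑ ⋁ f
⋁-ub {zero}  f zero    = ⊑-refl
⋁-ub {suc k} f zero    = ∨-ubˡ
⋁-ub {suc k} f (suc i) = ⊑-trans (⋁-ub (f ∘ suc) i) ∨-ubʳ

eval-∘ : ∀ {a b c} (ρ : Fin b → F c) (τ : Fin a → F b) t →
         eval ρ (eval τ t) ≡ eval (eval ρ ∘ τ) t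
eval-∘ ρ τ (var i)  = refl
eval-∘ ρ τ (s ∧ₜ t) = cong₂ _∧ₜ_ (eval-∘ ρ τ s) (eval-∘ ρ τ t)
eval-∘ ρ τ (s ∨ₜ t) = cong₂ _∨ₜ_ (eval-∘ ρ τ s) (eval-∘ ρ τ t)

eval-cong : ∀ {a b} {ρ ρ′ : Fin a → F b} → (∀ i → ρ i ≡ ρ′ i) → ∀ t → eval ρ t ≡ eval ρ′ t
eval-cong ρ≗ρ′ (var i)  = ρ≗ρ′ i
eval-cong ρ≗ρ′ (s ∧ₜ t) = cong₂ _∧ₜ_ (eval-cong ρ≗ρ′ s) (eval-cong ρ≗ρ′ t)
eval-cong ρ≗ρ′ (s ∨ₜ t) = cong₂ _∨ₜ_ (eval-cong ρ≗ρ′ s) (eval-cong ρ≗ρ′ t)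

eval-var : ∀ {a} (t : Term a) → eval var t ≡ t
eval-var (var i)  = refl
eval-var (s ∧ₜ t) = cong₂ _∧ₜ_ (eval-var s) (eval-var t)
eval-var (s ∨ₜ t) = cong₂ _∨ₜ_ (eval-var s) (eval-var t)

evalℕ : ∀ {m} → (Fin m → ℕ) → Term m → ℕ
evalℕ g (var i)  = g i
evalℕ g (s ∧ₜ t) = evalℕ g s ⊓ evalℕ g t
evalℕ g (s ∨ₜ t) = evalℕ g s ⊔ evalℕ g t

evalℕ-mono : ∀ {m} (g : Fin m → ℕ) {s t : Term m} → s ⊑ t → evalℕ g s ≤ evalℕ g t
evalℕ-mono g ⊑-refl                = ≤-refl
evalℕ-mono g (⊑-trans s⊑t t⊑u)     = ≤-trans (evalℕ-mono g s⊑t) (evalℕ-mono g t⊑u)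
evalℕ-mono g (∧-lbˡ {s} {t})       = m⊓n≤m (evalℕ g s) (evalℕ g t)
evalℕ-mono g (∧-lbʳ {s} {t})       = m⊓n≤n (evalℕ g s) (evalℕ g t)
evalℕ-mono g (∧-glb u⊑s u⊑t)       = ⊓-glb (evalℕ-mono g u⊑s) (evalℕ-mono g u⊑t)
evalℕ-mono g (∨-ubˡ {s} {t})       = m≤m⊔n (evalℕ g s) (evalℕ g t)
evalℕ-mono g (∨-ubʳ {s} {t})       = m≤n⊔m (evalℕ g s) (evalℕ g t)
evalℕ-mono g (∨-lub s⊑u t⊑u)       = ⊔-lub (evalℕ-mono g s⊑u) (evalℕ-mono g t⊑u)

evalℕ-eval : ∀ {a b} (g : Fin b → ℕ) (ρ : Fin a → F b) t →
             evalℕ g (eval ρ t) ≡ evalℕ (evalℕ g ∘ ρ) t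
evalℕ-eval g ρ (var i)  = refl
evalℕ-eval g ρ (s ∧ₜ t) = cong₂ _⊓_ (evalℕ-eval g ρ s) (evalℕ-eval g ρ t)
evalℕ-eval g ρ (s ∨ₜ t) = cong₂ _⊔_ (evalℕ-eval g ρ s) (evalℕ-eval g ρ t)

evalℕ-⋀-attained : ∀ {k m} (g : Fin m → ℕ) (f : Fin (suc k) → Term m) →
                   ∃ λ j → evalℕ g (⋀ f) ≡ evalℕ g (f j)
evalℕ-⋀-attained {zero}  g f = zero , refl
evalℕ-⋀-attained {suc k} g f with ⊓-sel (evalℕ g (f zero)) (evalℕ g (⋀ (f ∘ suc)))
... | inj₁ min≡head = zero , min≡head
... | inj₂ min≡rest with evalℕ-⋀-attained g (f ∘ suc)
...   | j , rest≡fj = suc j , trans min≡rest rest≡fj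

evalℕ-⋁-attained : ∀ {k m} (g : Fin m → ℕ) (f : Fin (suc k) → Term m) →
                   ∃ λ j → evalℕ g (⋁ f) ≡ evalℕ g (f j)
evalℕ-⋁-attained {zero}  g f = zero , refl
evalℕ-⋁-attained {suc k} g f with ⊔-sel (evalℕ g (f zero)) (evalℕ g (⋁ (f ∘ suc)))
... | inj₁ max≡head = zero , max≡head
... | inj₂ max≡rest with evalℕ-⋁-attained g (f ∘ suc)
...   | j , rest≡fj = suc j , trans max≡rest rest≡fj

<-evalℕ-⋀ : ∀ {k m} (g : Fin m → ℕ) (f : Fin (suc k) → Term m) {V} →
            (∀ i → V < evalℕ g (f i)) → V < evalℕ g (⋀ f)
<-evalℕ-⋀ {zero}  g f V<f = V<f zero
<-evalℕ-⋀ {suc k} g f V<f = ⊓-glb (V<f zero) (<-evalℕ-⋀ g (f ∘ suc) (V<f ∘ suc))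

evalℕ-⋁-< : ∀ {k m} (g : Fin m → ℕ) (f : Fin (suc k) → Term m) {V} →
            (∀ i → evalℕ g (f i) < V) → evalℕ g (⋁ f) < V
evalℕ-⋁-< {zero}  g f f<V = f<V zero
evalℕ-⋁-< {suc k} g f f<V = ⊔-lub (f<V zero) (evalℕ-⋁-< g (f ∘ suc) (f<V ∘ suc))

missedValue : ∀ {k} (a : Fin k → ℕ) → ∃ λ (v : Fin (suc k)) → ∀ i → a i ≢ toℕ v
missedValue {k} a with ¬∀⟶∃¬ (suc k) Hit (λ v → any? (λ i → a i ≟ toℕ v)) ¬surjective
  where
  Hit : Fin (suc k) → Set
  Hit v = ∃ λ i → a i ≡ toℕ v
  ¬surjective : ¬ (∀ v → Hit v)
  ¬surjective hit with pigeonhole (n<1+n k) (proj₁ ∘ hit)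
  ... | u , v , u<v , same =
    <⇒≢ u<v (trans (sym (proj₂ (hit u))) (trans (cong a same) (proj₂ (hit v))))
... | v , ¬hit = v , λ i aᵢ≡v → ¬hit (i , aᵢ≡v)

⋀Subsets : ∀ {m} k → (Subset k → PQF m) → PQF m
⋀Subsets zero    φ = φ []
⋀Subsets (suc k) φ = ⋀Subsets k (φ ∘ (inside ∷_)) and ⋀Subsets k (φ ∘ (outside ∷_))

⋀Subsets-elim : ∀ {m n} (ρ : Fin m → F n) k φ →
                SatQF n ρ (⋀Subsets k φ) → ∀ S → SatQF n ρ (φ S)
⋀Subsets-elim ρ zero    φ sat []            = sat
⋀Subsets-elim ρ (suc k) φ sat (inside ∷ S)  = ⋀Subsets-elim ρ k _ (proj₁ sat) S
⋀Subsets-elim ρ (suc k) φ sat (outside ∷ S) = ⋀Subsets-elim ρ k _ (proj₂ sat) S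

⋀Subsets-intro : ∀ {m n} (ρ : Fin m → F n) k φ →
                 (∀ S → SatQF n ρ (φ S)) → SatQF n ρ (⋀Subsets k φ)
⋀Subsets-intro ρ zero    φ sat = sat []
⋀Subsets-intro ρ (suc k) φ sat =
  ⋀Subsets-intro ρ k _ (sat ∘ (inside ∷_)) , ⋀Subsets-intro ρ k _ (sat ∘ (outside ∷_))

module Separation (k : ℕ) where

  N : ℕ
  N = suc k

  bottom top : Term N
  bottom = ⋀ var
  top    = ⋁ var

  -- Empty meets and joins are read as top and bottom respectively.
  meetOf joinOutside : Subset N → Term N
  meetOf      S = ⋀ λ i → if lookup S i then var i else top
  joinOutside S = ⋁ λ i → if lookup S i then bottom else var i

  weaken : Term N → Term (N + 1)
  weaken = eval (λ i → var (i ↑ˡ 1))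

  y : Term (N + 1)
  y = var (N ↑ʳ zero)

  splitClause : Subset N → PQF (N + 1)
  splitClause S = (weaken (meetOf S) ≼ y) or (y ≼ weaken (joinOutside S))

  matrix : PQF (N + 1)
  matrix = (weaken bottom ≼ y) and ((y ≼ weaken top) and ⋀Subsets N splitClause)

  σ : PosEA
  σ = ∃∀[ N , 1 , matrix ]

  module _ {n : ℕ} (α : Fin N → F n) (β : Fin 1 → F n) where

    eval-weaken : ∀ t → eval (α ⊕ β) (weaken t) ≡ eval α t
    eval-weaken t =
      trans (eval-∘ (α ⊕ β) _ t) (eval-cong (λ i → cong [ α , β ] (splitAt-↑ˡ N i 1)) t)

    eval-y : eval (α ⊕ β) y ≡ β zero
    eval-y = cong [ α , β ] (splitAt-↑ʳ N 1 zero)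

  bottom-least : ∀ t → bottom ⊑ t
  bottom-least (var i)  = ⋀-lb var i
  bottom-least (s ∧ₜ t) = ∧-glb (bottom-least s) (bottom-least t)
  bottom-least (s ∨ₜ t) = ⊑-trans (bottom-least s) ∨-ubˡ

  top-greatest : ∀ t → t ⊑ top
  top-greatest (var i)  = ⋁-ub var i
  top-greatest (s ∧ₜ t) = ⊑-trans ∧-lbˡ (top-greatest s)
  top-greatest (s ∨ₜ t) = ∨-lub (top-greatest s) (top-greatest t)

  split : ∀ S t → meetOf S ⊑ t ⊎ t ⊑ joinOutside S
  split S (var i) with lookup S i | ⋀-lb (λ j → if lookup S j then var j else top) i
                                  | ⋁-ub (λ j → if lookup S j then bottom else var j) i
  ... | inside  | meet⊑xᵢ | _       = inj₁ meet⊑xᵢ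
  ... | outside | _       | xᵢ⊑join = inj₂ xᵢ⊑join
  split S (s ∧ₜ t) with split S s | split S t
  ... | inj₁ m⊑s | inj₁ m⊑t = inj₁ (∧-glb m⊑s m⊑t)
  ... | inj₂ s⊑j | _        = inj₂ (⊑-trans ∧-lbˡ s⊑j)
  ... | inj₁ _   | inj₂ t⊑j = inj₂ (⊑-trans ∧-lbʳ t⊑j)
  split S (s ∨ₜ t) with split S s | split S t
  ... | inj₂ s⊑j | inj₂ t⊑j = inj₂ (∨-lub s⊑j t⊑j)
  ... | inj₁ m⊑s | _        = inj₁ (⊑-trans m⊑s ∨-ubˡ)
  ... | inj₂ _   | inj₁ m⊑t = inj₁ (⊑-trans m⊑t ∨-ubʳ)

  F-N⊨σ : N ⊨ σ
  F-N⊨σ = var , sat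
    where
    sat : (β : Fin 1 → F N) → SatQF N (var ⊕ β) matrix
    sat β = below (bottom-least t) , above (top-greatest t) , ⋀Subsets-intro ρ N splitClause clause
      where
      ρ : Fin (N + 1) → F N
      ρ = var ⊕ β

      t : F N
      t = β zero

      eval-weaken-var : ∀ s → eval ρ (weaken s) ≡ s
      eval-weaken-var s = trans (eval-weaken var β s) (eval-var s)

      below : ∀ {s} → s ⊑ t → SatQF N ρ (weaken s ≼ y)
      below = subst₂ _⊑_ (sym (eval-weaken-var _)) (sym (eval-y var β))

      above : ∀ {s} → t ⊑ s → SatQF N ρ (y ≼ weaken s)
      above = subst₂ _⊑_ (sym (eval-y var β)) (sym (eval-weaken-var _))

      clause : ∀ S → SatQF N ρ (splitClause S)
      clause S = Sum.map below above (split S t)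

  chain-¬split : (a : Fin N → ℕ) {V : ℕ} → (∀ i → a i ≢ V) →
                 evalℕ a bottom ≤ V → V ≤ evalℕ a top →
                 Σ (Subset N) λ S → V < evalℕ a (meetOf S) × evalℕ a (joinOutside S) < V
  chain-¬split a {V} a≢V bottom≤V V≤top =
    S , <-evalℕ-⋀ a _ V<member , evalℕ-⋁-< a _ nonMember<V
    where
    S : Subset N
    S = tabulate λ i → does (V <? a i)

    bottom<V : evalℕ a bottom < V
    bottom<V with evalℕ-⋀-attained a var
    ... | j , bottom≡aⱼ = ≤∧≢⇒< bottom≤V λ bottom≡V → a≢V j (trans (sym bottom≡aⱼ) bottom≡V)

    V<top : V < evalℕ a top
    V<top with evalℕ-⋁-attained a var
    ... | j , top≡aⱼ = ≤∧≢⇒< V≤top λ V≡top → a≢V j (trans (sym top≡aⱼ) (sym V≡top))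

    V<member : ∀ i → V < evalℕ a (if lookup S i then var i else top)
    V<member i rewrite lookup∘tabulate (λ j → does (V <? a j)) i = by (V <? a i)
      where
      by : (V<aᵢ? : Dec (V < a i)) → V < evalℕ a (if does V<aᵢ? then var i else top)
      by (yes V<aᵢ) = V<aᵢ
      by (no  _)    = V<top

    nonMember<V : ∀ i → evalℕ a (if lookup S i then bottom else var i) < V
    nonMember<V i rewrite lookup∘tabulate (λ j → does (V <? a j)) i = by (V <? a i)
      where
      by : (V<aᵢ? : Dec (V < a i)) → evalℕ a (if does V<aᵢ? then bottom else var i) < V
      by (yes _)    = bottom<V
      by (no  V≮aᵢ) = ≤∧≢⇒< (≮⇒≥ V≮aᵢ) (a≢V i)

  F-sucN⊭σ : ¬ (suc N ⊨ σ)
  F-sucN⊭σ (α , sat) = refute (sat β)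
    where
    a : Fin N → ℕ
    a = evalℕ toℕ ∘ α

    v : Fin (suc N)
    v = proj₁ (missedValue a)

    β : Fin 1 → F (suc N)
    β _ = var v

    ρ : Fin (N + 1) → F (suc N)
    ρ = α ⊕ β

    evalℕ-weaken : ∀ s → evalℕ toℕ (eval ρ (weaken s)) ≡ evalℕ a s
    evalℕ-weaken s = trans (cong (evalℕ toℕ) (eval-weaken α β s)) (evalℕ-eval toℕ α s)

    evalℕ-y : evalℕ toℕ (eval ρ y) ≡ toℕ v
    evalℕ-y = cong (evalℕ toℕ) (eval-y α β)

    below⇒≤ : ∀ {s} → SatQF (suc N) ρ (weaken s ≼ y) → evalℕ a s ≤ toℕ v
    below⇒≤ {s} = subst₂ _≤_ (evalℕ-weaken s) evalℕ-y ∘ evalℕ-mono toℕ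

    above⇒≥ : ∀ {s} → SatQF (suc N) ρ (y ≼ weaken s) → toℕ v ≤ evalℕ a s
    above⇒≥ {s} = subst₂ _≤_ evalℕ-y (evalℕ-weaken s) ∘ evalℕ-mono toℕ

    refute : ¬ SatQF (suc N) ρ matrix
    refute (bottom≼y , y≼top , clauses)
      with chain-¬split a (proj₂ (missedValue a))
                        (below⇒≤ {bottom} bottom≼y) (above⇒≥ {top} y≼top)
    ... | S , V<meet , join<V =
      [ <⇒≱ V<meet ∘ below⇒≤ {meetOf S} , <⇒≱ join<V ∘ above⇒≥ {joinOutside S} ]
        (⋀Subsets-elim ρ N splitClause clauses S)

theorem1p4 : (n : ℕ) → n ≥ 1 →
    Σ PosEA λ σ → (n ⊨ σ) × ¬ (suc n ⊨ σ)
theorem1p4 zero    ()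
theorem1p4 (suc k) _ = σ , F-N⊨σ , F-sucN⊭σ
  where open Separation k
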